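{- Let $G=(C\cup S,E)$ be a finite bipartite graph with $C\ne\emptyset$ and $|N(c)|\ge1$ for all $c\in C$, and let $\alpha$ be a balanced server flow. Let $\widehat\alpha=\max_{s\in S}\alpha(s)$, $\widehat S=\{s\in S:\alpha(s)=\widehat\alpha\}$, and $\widehat K=\{c\in C: A(c)\cap\widehat S\ne\emptyset\}$. Then $N(\widehat K)=\widehat S$ and $|\widehat K|=\widehat\alpha\,|\widehat S|$.
   Context: A server flow is a map $\alpha:S\to\mathbb R_{\ge0}$ for which there exist nonnegative reals $(x_e)_{e\in E}$ with $\sum_{s\in N(c)}x_{cs}=1$ for every $c\in C$ and $\sum_{c\in N(s)}x_{cs}=\alpha(s)$ for every $s\in S$. It is balanced if such $x$ can be chosen with $x_{cs}=0$ whenever $s\in N(c)\setminus A(c)$, where $A(c)=\arg\min_{s\in N(c)}\alpha(s)$ (the active neighbors of $c$). $N(K)=\bigcup_{c\in K}N(c)$.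
   Formalization: The balanced server flow α and its edge weights $(x_e)_{e\in E}$ take nonnegative rational values instead of nonnegative real ones. -}

module Defs where

open import Data.Nat using (ℕ; zero; suc)
open import Data.Fin using (Fin; zero; suc)
open import Data.Fin.Properties using (any?; all?)
open import Data.Bool using (Bool; true; false)
import Data.Bool.Properties as BoolP
open import Data.Integer using (+_)
open import Data.Rational using (ℚ; 0ℚ; 1ℚ; _+_; _≤_; _/_)
import Data.Rational.Properties as ℚP
open import Data.List using (List; length; filter)
open import Data.List.Base using (allFin)
open import Data.Product using (Σ; ∃; _×_; _,_)
open import Relation.Binary.PropositionalEquality using (_≡_)
open import Relation.Nullary using (Dec; ¬_)
open import Relation.Nullary.Decidable using (_×-dec_; _→-dec_)
open import Relation.Unary using (Pred; Decidable)

-- A finite bipartite graph G = (C ∪ S, E) with C = Fin m (clients) and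
-- S = Fin n (servers); adj c s ≡ true iff {c,s} ∈ E.
Graph : ℕ → ℕ → Set
Graph m n = Fin m → Fin n → Bool

Edge : ∀ {m n} → Graph m n → Fin m → Fin n → Set
Edge G c s = G c s ≡ true

Σℚ : ∀ {k} → (Fin k → ℚ) → ℚ
Σℚ {zero}  f = 0ℚ
Σℚ {suc k} f = f zero + Σℚ (λ i → f (suc i))

card : ∀ {k ℓ} {P : Pred (Fin k) ℓ} → Decidable P → ℕ
card P? = length (filter P? (allFin _))

ℕ→ℚ : ℕ → ℚ
ℕ→ℚ k = (+ k) / 1

-- x = (x_e)_{e ∈ E} witnesses that α is a server flow. x is stored as a
-- C × S matrix that vanishes off E.
IsFlowWitness : ∀ {m n} → Graph m n → (Fin n → ℚ) → (Fin m → Fin n → ℚ) → Set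
IsFlowWitness G α x =
  (∀ c s → Edge G c s → 0ℚ ≤ x c s) ×
  (∀ c s → G c s ≡ false → x c s ≡ 0ℚ) ×
  (∀ c → Σℚ (λ s → x c s) ≡ 1ℚ) ×
  (∀ s → Σℚ (λ c → x c s) ≡ α s)

ServerFlow : ∀ {m n} → Graph m n → (Fin n → ℚ) → Set
ServerFlow G α = (∀ s → 0ℚ ≤ α s) × ∃ λ x → IsFlowWitness G α x

Active : ∀ {m n} → Graph m n → (Fin n → ℚ) → Fin m → Fin n → Set
Active G α c s = Edge G c s × (∀ s′ → Edge G c s′ → α s ≤ α s′)

Balanced : ∀ {m n} → Graph m n → (Fin n → ℚ) → Set
Balanced G α =
  (∀ s → 0ℚ ≤ α s) ×
  ∃ λ x → IsFlowWitness G α x ×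
          (∀ c s → Edge G c s → ¬ Active G α c s → x c s ≡ 0ℚ)

IsMax : ∀ {n} → (Fin n → ℚ) → ℚ → Set
IsMax α a = (∃ λ s → α s ≡ a) × (∀ s → α s ≤ a)

Shat : ∀ {n} → (Fin n → ℚ) → ℚ → Fin n → Set
Shat α a s = α s ≡ a

Khat : ∀ {m n} → Graph m n → (Fin n → ℚ) → ℚ → Fin m → Set
Khat G α a c = ∃ λ s → Active G α c s × Shat α a s

InNbhd : ∀ {m n} → Graph m n → (Fin m → Set) → Fin n → Set
InNbhd G K s = ∃ λ c → K c × Edge G c s

Shat? : ∀ {n} (α : Fin n → ℚ) (a : ℚ) → Decidable (Shat α a)
Shat? α a s = α s ℚP.≟ a

Active? : ∀ {m n} (G : Graph m n) (α : Fin n → ℚ) (c : Fin m) → Decidable (Active G α c)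
Active? G α c s =
  (G c s BoolP.≟ true) ×-dec
  all? (λ s′ → (G c s′ BoolP.≟ true) →-dec (α s ℚP.≤? α s′))

Khat? : ∀ {m n} (G : Graph m n) (α : Fin n → ℚ) (a : ℚ) → Decidable (Khat G α a)
Khat? G α a c = any? (λ s → Active? G α c s ×-dec Shat? α a s)

{-# OPTIONS --safe #-}
-- Since α̂ is the maximum of α, a client with an active server in Ŝ has all of
-- its neighbours in Ŝ; and on the support of a balanced witness x (active
-- edges only) c ∈ K̂ holds exactly when s ∈ Ŝ.  So N(K̂) ⊆ Ŝ, and each s ∈ Ŝ,
-- which receives α̂ > 0 units of flow, receives some from a client of K̂.
-- Counting Σ_{c ∈ K̂, s ∈ Ŝ} x_cs by rows (each sums to 1) and by columns
-- (each sums to α̂) gives |K̂| = α̂ |Ŝ|.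
module Submission where

open import Defs
open import Data.Nat using (ℕ; _<_)
open import Data.Fin using (Fin)
open import Data.Rational using (ℚ; _*_)
open import Data.Product using (∃; _×_)
open import Relation.Binary.PropositionalEquality using (_≡_)
open import Function.Bundles using (_⇔_)

open import Data.Nat using (zero; suc; s≤s)
import Data.Nat.Properties as ℕP
open import Data.Fin using (zero; suc; punchIn)
open import Data.Vec.Functional using (removeAt)
open import Data.Fin.Properties using (¬∀⟶∃¬)
open import Data.Integer using (+_)
open import Data.Rational using (0ℚ; 1ℚ; _+_; _≤_; _/_)
import Data.Rational.Properties as ℚP
open import Data.Nat.Coprimality using (1-coprimeTo) renaming (sym to coprime-sym)
open import Data.List using (length; filter; tabulate)
open import Data.Bool using (true; false)
open import Data.Product using (_,_; proj₁)
open import Data.Empty using (⊥-elim)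
open import Function.Bundles using (mk⇔; Equivalence)
open import Relation.Binary.PropositionalEquality
  using (_≢_; refl; sym; trans; cong; subst; module ≡-Reasoning)
open import Relation.Nullary using (Dec; yes; no; ¬_)
open import Relation.Unary using (Pred; Decidable)
open import Algebra.Bundles using (CommutativeRing)
open import Algebra.Properties.Semiring.Sum (CommutativeRing.semiring ℚP.+-*-commutativeRing)
  using (sum; sum-cong-≗; sum-replicate-zero; sum-remove; ∑-comm; *-distribˡ-sum)

Σℚ≡sum : ∀ {k} (f : Fin k → ℚ) → Σℚ f ≡ sum f
Σℚ≡sum {zero}  f = refl
Σℚ≡sum {suc _} f = cong (_+_ (f zero)) (Σℚ≡sum (λ i → f (suc i)))

sum-nonneg : ∀ {k} (f : Fin k → ℚ) → (∀ i → 0ℚ ≤ f i) → 0ℚ ≤ sum f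
sum-nonneg {zero}  f f≥0 = ℚP.≤-refl
sum-nonneg {suc _} f f≥0 =
  ℚP.+-mono-≤ (f≥0 zero) (sum-nonneg (λ i → f (suc i)) (λ i → f≥0 (suc i)))

term≤sum : ∀ {k} (f : Fin k → ℚ) → (∀ i → 0ℚ ≤ f i) → ∀ i → f i ≤ sum f
term≤sum {suc _} f f≥0 i = begin
  f i                          ≡⟨ sym (ℚP.+-identityʳ (f i)) ⟩
  f i + 0ℚ                     ≤⟨ ℚP.+-monoʳ-≤ (f i) (sum-nonneg (removeAt f i) (λ j → f≥0 (punchIn i j))) ⟩
  f i + sum (removeAt f i)     ≡⟨ sym (sum-remove {i = i} f) ⟩
  sum f                        ∎
  where
  open ℚP.≤-Reasoning

sum≢0⇒term≢0 : ∀ {k} (f : Fin k → ℚ) → sum f ≢ 0ℚ → ∃ λ i → f i ≢ 0ℚ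
sum≢0⇒term≢0 {k} f sum≢0 = ¬∀⟶∃¬ k _ (λ i → f i ℚP.≟ 0ℚ)
  (λ f≡0 → sum≢0 (trans (sum-cong-≗ f≡0) (sum-replicate-zero k)))

indicator : ∀ {ℓ} {A : Set ℓ} → Dec A → ℚ
indicator (yes _) = 1ℚ
indicator (no _)  = 0ℚ

indicator-cong : ∀ {ℓ ℓ′} {A : Set ℓ} {B : Set ℓ′} → A ⇔ B →
  (a? : Dec A) (b? : Dec B) → indicator a? ≡ indicator b?
indicator-cong _   (yes _) (yes _) = refl
indicator-cong A⇔B (yes a) (no ¬b) = ⊥-elim (¬b (Equivalence.to A⇔B a))
indicator-cong A⇔B (no ¬a) (yes b) = ⊥-elim (¬a (Equivalence.from A⇔B b))
indicator-cong _   (no _)  (no _)  = refl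

indicator-≡-scale : ∀ {p q : ℚ} (p≟q : Dec (p ≡ q)) → indicator p≟q * p ≡ q * indicator p≟q
indicator-≡-scale {p} {q} (yes p≡q) = trans (ℚP.*-identityˡ p) (trans p≡q (sym (ℚP.*-identityʳ q)))
indicator-≡-scale {p} {q} (no _)    = trans (ℚP.*-zeroˡ p) (sym (ℚP.*-zeroʳ q))

-- For k ≥ 1 the normalising division in + k / 1 is stuck; rewriting it to its
-- normal form mkℚ (+ k) 0 _ lets the addition on the right compute.
ℕ→ℚ-suc : ∀ k → ℕ→ℚ (suc k) ≡ 1ℚ + ℕ→ℚ k
ℕ→ℚ-suc zero    = refl
ℕ→ℚ-suc (suc k) rewrite ℚP.normalize-coprime (coprime-sym (1-coprimeTo (suc k))) =
  cong (λ j → + suc j / 1) (sym (ℕP.*-identityʳ (suc k)))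

length-filter-tabulate : ∀ {k j ℓ} {P : Pred (Fin j) ℓ} (P? : Decidable P) (f : Fin k → Fin j) →
  ℕ→ℚ (length (filter P? (tabulate f))) ≡ sum (λ i → indicator (P? (f i)))
length-filter-tabulate {zero}  P? f = refl
length-filter-tabulate {suc k} P? f with P? (f zero)
... | yes _ = trans (ℕ→ℚ-suc (length (filter P? (tabulate (λ i → f (suc i))))))
                  (cong (_+_ 1ℚ) (length-filter-tabulate P? (λ i → f (suc i))))
... | no _  = trans (length-filter-tabulate P? (λ i → f (suc i))) (sym (ℚP.+-identityˡ _))

card≡sum-indicator : ∀ {k ℓ} {P : Pred (Fin k) ℓ} (P? : Decidable P) →
  ℕ→ℚ (card P?) ≡ sum (λ i → indicator (P? i))
card≡sum-indicator P? = length-filter-tabulate P? (λ i → i)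

double-counting : ∀ {m n} (x : Fin m → Fin n → ℚ) (α : Fin n → ℚ) →
  (∀ c → sum (x c) ≡ 1ℚ) → (∀ s → sum (λ c → x c s) ≡ α s) →
  (k : Fin m → ℚ) (w : Fin n → ℚ) → (∀ c s → k c * x c s ≡ w s * x c s) →
  sum k ≡ sum (λ s → w s * α s)
double-counting x α rows cols k w kx≡wx = begin
  sum k                                ≡⟨ sum-cong-≗ (λ c → sym (ℚP.*-identityʳ (k c))) ⟩
  sum (λ c → k c * 1ℚ)                 ≡⟨ sum-cong-≗ (λ c → cong (k c *_) (sym (rows c))) ⟩
  sum (λ c → k c * sum (x c))          ≡⟨ sum-cong-≗ (λ c → *-distribˡ-sum (k c) (x c)) ⟩
  sum (λ c → sum (λ s → k c * x c s))  ≡⟨ sum-cong-≗ (λ c → sum-cong-≗ (kx≡wx c)) ⟩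
  sum (λ c → sum (λ s → w s * x c s))  ≡⟨ ∑-comm (λ c s → w s * x c s) ⟩
  sum (λ s → sum (λ c → w s * x c s))  ≡⟨ sum-cong-≗ (λ s → sym (*-distribˡ-sum (w s) (λ c → x c s))) ⟩
  sum (λ s → w s * sum (λ c → x c s))  ≡⟨ sum-cong-≗ (λ s → cong (w s *_) (cols s)) ⟩
  sum (λ s → w s * α s)                ∎
  where open ≡-Reasoning

module BalancedWitness {m n} (G : Graph m n) (α : Fin n → ℚ) (x : Fin m → Fin n → ℚ)
  (x-nonneg-on-E : ∀ c s → Edge G c s → 0ℚ ≤ x c s)
  (x-zero-off-E : ∀ c s → G c s ≡ false → x c s ≡ 0ℚ)
  (row-Σℚ : ∀ c → Σℚ (x c) ≡ 1ℚ)
  (column-Σℚ : ∀ s → Σℚ (λ c → x c s) ≡ α s)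
  (x-zero-off-A : ∀ c s → Edge G c s → ¬ Active G α c s → x c s ≡ 0ℚ)
  where

  row-sum : ∀ c → sum (x c) ≡ 1ℚ
  row-sum c = trans (sym (Σℚ≡sum (x c))) (row-Σℚ c)

  column-sum : ∀ s → sum (λ c → x c s) ≡ α s
  column-sum s = trans (sym (Σℚ≡sum (λ c → x c s))) (column-Σℚ s)

  x-nonneg : ∀ c s → 0ℚ ≤ x c s
  x-nonneg c s with G c s in e
  ... | true  = x-nonneg-on-E c s e
  ... | false = ℚP.≤-reflexive (sym (x-zero-off-E c s e))

  x≢0⇒Edge : ∀ {c s} → x c s ≢ 0ℚ → Edge G c s
  x≢0⇒Edge {c} {s} x≢0 with G c s in e
  ... | true  = refl
  ... | false = ⊥-elim (x≢0 (x-zero-off-E c s e))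

  x≢0⇒Active : ∀ {c s} → x c s ≢ 0ℚ → Active G α c s
  x≢0⇒Active {c} {s} x≢0 with Active? G α c s
  ... | yes act = act
  ... | no ¬act = ⊥-elim (x≢0 (x-zero-off-A c s (x≢0⇒Edge x≢0) ¬act))

  module AtMaximum (a : ℚ) (α≤a : ∀ s → α s ≤ a) where

    Khat-Edge⇒Shat : ∀ {c s} → Khat G α a c → Edge G c s → Shat α a s
    Khat-Edge⇒Shat {s = s} (s₀ , (_ , s₀-min) , αs₀≡a) e =
      ℚP.≤-antisym (α≤a s) (subst (_≤ α s) αs₀≡a (s₀-min s e))

    Active⇒[Khat⇔Shat] : ∀ {c s} → Active G α c s → Khat G α a c ⇔ Shat α a s
    Active⇒[Khat⇔Shat] {s = s} act =
      mk⇔ (λ c∈K̂ → Khat-Edge⇒Shat c∈K̂ (proj₁ act)) (λ s∈Ŝ → s , act , s∈Ŝ)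

    max≢0 : Fin m → a ≢ 0ℚ
    max≢0 c₀ a≡0 with sum≢0⇒term≢0 (x c₀) (λ eq → ℚP.1≢0 (trans (sym (row-sum c₀)) eq))
    ... | s , x≢0 = x≢0 (ℚP.≤-antisym x≤0 (x-nonneg c₀ s))
      where
      open ℚP.≤-Reasoning
      x≤0 : x c₀ s ≤ 0ℚ
      x≤0 = begin
        x c₀ s              ≤⟨ term≤sum (λ c → x c s) (λ c → x-nonneg c s) c₀ ⟩
        sum (λ c → x c s)   ≡⟨ column-sum s ⟩
        α s                 ≤⟨ α≤a s ⟩
        a                   ≡⟨ a≡0 ⟩
        0ℚ                  ∎

    N[Khat]⇔Shat : Fin m → ∀ s → InNbhd G (Khat G α a) s ⇔ Shat α a s
    N[Khat]⇔Shat c₀ s = mk⇔ (λ (c , c∈K̂ , e) → Khat-Edge⇒Shat c∈K̂ e) supplier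
      where
      supplier : Shat α a s → InNbhd G (Khat G α a) s
      supplier s∈Ŝ with sum≢0⇒term≢0 (λ c → x c s)
                          (λ eq → max≢0 c₀ (trans (sym s∈Ŝ) (trans (sym (column-sum s)) eq)))
      ... | c , x≢0 = c , (s , act , s∈Ŝ) , proj₁ act
        where act = x≢0⇒Active x≢0

    𝟙K̂ : Fin m → ℚ
    𝟙K̂ c = indicator (Khat? G α a c)

    𝟙Ŝ : Fin n → ℚ
    𝟙Ŝ s = indicator (Shat? α a s)

    𝟙K̂*x≡𝟙Ŝ*x : ∀ c s → 𝟙K̂ c * x c s ≡ 𝟙Ŝ s * x c s
    𝟙K̂*x≡𝟙Ŝ*x c s with x c s ℚP.≟ 0ℚ
    ... | yes x≡0 rewrite x≡0 = trans (ℚP.*-zeroʳ (𝟙K̂ c)) (sym (ℚP.*-zeroʳ (𝟙Ŝ s)))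
    ... | no x≢0 = cong (_* x c s)
      (indicator-cong (Active⇒[Khat⇔Shat] (x≢0⇒Active x≢0)) (Khat? G α a c) (Shat? α a s))

    card-Khat≡max*card-Shat : ℕ→ℚ (card (Khat? G α a)) ≡ a * ℕ→ℚ (card (Shat? α a))
    card-Khat≡max*card-Shat = begin
      ℕ→ℚ (card (Khat? G α a))  ≡⟨ card≡sum-indicator (Khat? G α a) ⟩
      sum 𝟙K̂                    ≡⟨ double-counting x α row-sum column-sum 𝟙K̂ 𝟙Ŝ 𝟙K̂*x≡𝟙Ŝ*x ⟩
      sum (λ s → 𝟙Ŝ s * α s)    ≡⟨ sum-cong-≗ (λ s → indicator-≡-scale (Shat? α a s)) ⟩
      sum (λ s → a * 𝟙Ŝ s)      ≡⟨ sym (*-distribˡ-sum a 𝟙Ŝ) ⟩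
      a * sum 𝟙Ŝ                ≡⟨ cong (a *_) (sym (card≡sum-indicator (Shat? α a))) ⟩
      a * ℕ→ℚ (card (Shat? α a)) ∎
      where open ≡-Reasoning

lemma17 : ∀ {m n} (G : Graph m n) (α : Fin n → ℚ) →
    0 < m →
    (∀ c → ∃ λ s → Edge G c s) →
    Balanced G α →
    (a : ℚ) → IsMax α a →
    (∀ s → InNbhd G (Khat G α a) s ⇔ Shat α a s) ×
    (ℕ→ℚ (card (Khat? G α a)) ≡ a * ℕ→ℚ (card (Shat? α a)))
lemma17 {suc _} G α (s≤s _) _ (_ , x , (x≥0 , x-off-E , rows , columns) , x-off-A) a (_ , α≤a) =
  N[Khat]⇔Shat zero , card-Khat≡max*card-Shat
  where open BalancedWitness G α x x≥0 x-off-E rows columns x-off-A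
        open AtMaximum a α≤a
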